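{- There is a constant $c$ such that the following hold. (i) For every polynomial $p$ and every set of polynomial equations $\mathcal F=\{f_i=0\}_{i=1}^\ell$ over $\mathbb{Q}$: if there is an algebraic IPS proof over $\mathbb{Q}$ of $p$ from $\mathcal F$ of size $s$, then there is a real CPS proof over $\mathbb{Q}$ of $p$ from the inequalities $\{f_i\ge0,\,-f_i\ge0\}_{i=1}^\ell$ of size at most $s^c$. (ii) For every ordered ring $R$, if there is a boolean IPS proof over $R$ of $p$ from $\mathcal F$ of size $s$, then there is a boolean CPS proof over $R$ of $p$ from $\mathcal F$ of size at most $s^c$.
   Context: Circuit size = number of nodes, each constant counting as one node. Algebraic IPS over a ring $R$: a proof of $p$ from $\{f_i=0\}_{i=1}^\ell$ is a circuit $C(\bar x,y_1,\dots,y_\ell)$ over $R$ with $C(\bar x,\bar0)=0$ and $C(\bar x,f_1,\dots,f_\ell)=p$ as formal polynomial identities; boolean IPS additionally has placeholder variables $z_1,\dots,z_n$ for the axioms $x_i^2-x_i$ (i.e. $C(\bar x,\bar0,\bar 0)=0$ and $C(\bar x,\bar f,x_1^2-x_1,\dots,x_n^2-x_n)=p$). A squaring gate is a product gate both of whose inputs come from one node; a circuit $C(\bar x,\bar y)$ is $\bar y$-conic if every leaf labelled by a negative constant or an $x$-variable has all its paths to the output passing through a squaring gate. Real CPS proof of $p$ from inequalities $h_1\ge0,\dots,h_m\ge0$: a $\bar y$-conic circuit $C(\bar x,y_1,\dots,y_m)$ with $C(\bar x,h_1,\dots,h_m)=p$ formally; size = size of $C$. Boolean CPS proof of $p$ from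 equations $\mathcal F$: a CPS proof from the inequality list consisting of $f\ge0$ and $-f\ge0$ for every $f=0$ in $\mathcal F$ and for every $x_i^2-x_i=0$, together with $x_i\ge0$ and $1-x_i\ge0$ for every variable. -}

module Defs where

open import Level using (Level; _⊔_; suc; Setω)
open import Data.Nat using (ℕ; zero) renaming (suc to sucℕ)
open import Data.Fin using (Fin; _≟_) renaming (zero to fzero; suc to fsuc)
open import Data.Sum using (_⊎_; inj₁; inj₂; [_,_])
open import Data.Empty using (⊥)
open import Data.Unit using (⊤)
open import Data.Product using (_×_)
open import Relation.Nullary using (¬_; does)
open import Data.Bool using (if_then_else_)
open import Relation.Binary using (Rel; IsTotalOrder)
open import Algebra.Bundles using (CommutativeRing)
import Data.Rational as ℚ
import Data.Rational.Properties as ℚP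

-- Dependent pair whose second component may live in Setω
-- (used so that the constant c can precede a quantification over
-- ordered rings of all universe levels).

record Σω (A : Set) (B : A → Setω) : Setω where
  constructor _,ω_
  field
    fst : A
    snd : B fst

record _×ω_ (A : Set) (B : Setω) : Setω where
  constructor _,_
  field
    fst : A
    snd : B

record OrderedCommRing (a ℓ₁ ℓ₂ : Level) : Set (suc (a ⊔ ℓ₁ ⊔ ℓ₂)) where
  field
    commutativeRing : CommutativeRing a ℓ₁
  open CommutativeRing commutativeRing public
  field
    _≤_          : Rel Carrier ℓ₂
    isTotalOrder : IsTotalOrder _≈_ _≤_
    +-mono-≤     : ∀ {x y} z → x ≤ y → (x + z) ≤ (y + z)
    0≤*          : ∀ {x y} → 0# ≤ x → 0# ≤ y → 0# ≤ (x * y)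

  Negative : Carrier → Set (ℓ₁ ⊔ ℓ₂)
  Negative x = (x ≤ 0#) × ¬ (x ≈ 0#)

module Poly {a ℓ} (R : CommutativeRing a ℓ) where
  open CommutativeRing R using (Carrier; _≈_; _+_; _*_; -_; 0#; 1#)

  infixl 6 _⊕_
  infixl 7 _⊗_

  data Term (V : Set) : Set a where
    var : V → Term V
    con : Carrier → Term V
    _⊕_ : Term V → Term V → Term V
    _⊗_ : Term V → Term V → Term V

  neg : ∀ {V} → Term V → Term V
  neg t = con (- 1#) ⊗ t

  -- equality of formal polynomials: the least congruence making
  -- Term V the free commutative R-algebra on V, i.e. R[V].
  infix 4 _≃_
  data _≃_ {V : Set} : Term V → Term V → Set (a ⊔ ℓ) where
    ≃-refl  : ∀ {s} → s ≃ s
    ≃-sym   : ∀ {s t} → s ≃ t → t ≃ s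
    ≃-trans : ∀ {s t u} → s ≃ t → t ≃ u → s ≃ u
    ⊕-cong  : ∀ {s s' t t'} → s ≃ s' → t ≃ t' → s ⊕ t ≃ s' ⊕ t'
    ⊗-cong  : ∀ {s s' t t'} → s ≃ s' → t ≃ t' → s ⊗ t ≃ s' ⊗ t'
    con-cong : ∀ {x y} → x ≈ y → con x ≃ con y
    con-+   : ∀ x y → con x ⊕ con y ≃ con (x + y)
    con-*   : ∀ x y → con x ⊗ con y ≃ con (x * y)
    ⊕-assoc : ∀ s t u → (s ⊕ t) ⊕ u ≃ s ⊕ (t ⊕ u)
    ⊕-comm  : ∀ s t → s ⊕ t ≃ t ⊕ s
    ⊕-idˡ   : ∀ s → con 0# ⊕ s ≃ s
    ⊕-invʳ  : ∀ s → s ⊕ neg s ≃ con 0#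
    ⊗-assoc : ∀ s t u → (s ⊗ t) ⊗ u ≃ s ⊗ (t ⊗ u)
    ⊗-comm  : ∀ s t → s ⊗ t ≃ t ⊗ s
    ⊗-idˡ   : ∀ s → con 1# ⊗ s ≃ s
    distribˡ : ∀ s t u → s ⊗ (t ⊕ u) ≃ (s ⊗ t) ⊕ (s ⊗ u)

  subst : ∀ {V W} → (V → Term W) → Term V → Term W
  subst σ (var v) = σ v
  subst σ (con x) = con x
  subst σ (s ⊕ t) = subst σ s ⊕ subst σ t
  subst σ (s ⊗ t) = subst σ s ⊗ subst σ t

  -- Algebraic circuits as straight-line programs (DAGs).
  -- A gate of a circuit with k earlier nodes refers to earlier nodes by
  -- Fin k, where fzero is the most recently added node.
  data Gate (V : Set) (k : ℕ) : Set a where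
    input : V → Gate V k
    const : Carrier → Gate V k
    add   : Fin k → Fin k → Gate V k
    mul   : Fin k → Fin k → Gate V k

  -- SLP V s : a circuit with exactly s nodes (its size); each constant
  -- leaf is one node.  The output is the last node added.
  infixl 5 _▷_
  data SLP (V : Set) : ℕ → Set a where
    []  : SLP V zero
    _▷_ : ∀ {k} → SLP V k → Gate V k → SLP V (sucℕ k)

  mutual
    node : ∀ {V k} → SLP V k → Fin k → Term V
    node (C ▷ g) fzero    = gate C g
    node (C ▷ g) (fsuc i) = node C i

    gate : ∀ {V k} → SLP V k → Gate V k → Term V
    gate C (input v) = var v
    gate C (const x) = con x
    gate C (add i j) = node C i ⊕ node C j
    gate C (mul i j) = node C i ⊗ node C j

  -- polynomial computed at the output (only used for nonempty circuits)
  out : ∀ {V k} → SLP V k → Term V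
  out []      = con 0#
  out (C ▷ g) = gate C g

  -- Unsafe C i: there is a path from a "bad" leaf (a leaf labelled by a
  -- variable v with Bad v, or by a constant x with Neg x) to node i
  -- not passing through any squaring gate (mul i i).
  module _ {b₁ b₂} {V : Set} (Bad : V → Set b₁) (Neg : Carrier → Set b₂) where
    mutual
      UnsafeNode : ∀ {k} → SLP V k → Fin k → Set (b₁ ⊔ b₂)
      UnsafeNode (C ▷ g) fzero    = UnsafeGate C g
      UnsafeNode (C ▷ g) (fsuc i) = UnsafeNode C i

      UnsafeGate : ∀ {k} → SLP V k → Gate V k → Set (b₁ ⊔ b₂)
      UnsafeGate C (input v) = Level.Lift (b₁ ⊔ b₂) (Bad v)
      UnsafeGate C (const x) = Level.Lift (b₁ ⊔ b₂) (Neg x)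
      UnsafeGate C (add i j) = UnsafeNode C i ⊎ UnsafeNode C j
      UnsafeGate C (mul i j) =
        if does (i ≟ j) then Level.Lift (b₁ ⊔ b₂) ⊥
                        else (UnsafeNode C i ⊎ UnsafeNode C j)

    UnsafeOut : ∀ {k} → SLP V k → Set (b₁ ⊔ b₂)
    UnsafeOut []      = Level.Lift (b₁ ⊔ b₂) ⊥
    UnsafeOut (C ▷ g) = UnsafeGate C g

  -- x-variables are the bad variables in a circuit C(x̄, ȳ)
  IsX : ∀ {n} {I : Set} → (Fin n ⊎ I) → Set
  IsX (inj₁ _) = ⊤
  IsX (inj₂ _) = ⊥

  Conic : ∀ {b n k} {I : Set} (Neg : Carrier → Set b) → SLP (Fin n ⊎ I) k → Set b
  Conic {b} Neg C = ¬ UnsafeOut IsX Neg C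

  zeroes : ∀ {n} {I : Set} → (Fin n ⊎ I) → Term (Fin n)
  zeroes = [ var , (λ _ → con 0#) ]

  record AlgIPS {n l : ℕ} (F : Fin l → Term (Fin n)) (p : Term (Fin n)) (s : ℕ)
         : Set (a ⊔ ℓ) where
    field
      circuit  : SLP (Fin n ⊎ Fin l) s
      nonempty : Data.Nat._≤_ 1 s
      at-zero  : subst zeroes (out circuit) ≃ con 0#
      at-F     : subst [ var , F ] (out circuit) ≃ p

  boolAx : ∀ {n} → Fin n → Term (Fin n)
  boolAx i = var i ⊗ var i ⊕ neg (var i)

  record BoolIPS {n l : ℕ} (F : Fin l → Term (Fin n)) (p : Term (Fin n)) (s : ℕ)
         : Set (a ⊔ ℓ) where
    field
      circuit  : SLP (Fin n ⊎ (Fin l ⊎ Fin n)) s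
      nonempty : Data.Nat._≤_ 1 s
      at-zero  : subst [ var , (λ _ → con 0#) ] (out circuit) ≃ con 0#
      at-F     : subst [ var , [ F , boolAx ] ] (out circuit) ≃ p

  record CPS {b} (Neg : Carrier → Set b) {n : ℕ} {I : Set}
         (H : I → Term (Fin n)) (p : Term (Fin n)) (s : ℕ) : Set (a ⊔ ℓ ⊔ b) where
    field
      circuit  : SLP (Fin n ⊎ I) s
      nonempty : Data.Nat._≤_ 1 s
      conic    : Conic Neg circuit
      at-H     : subst [ var , H ] (out circuit) ≃ p

  eqIneqs : ∀ {n l} → (Fin l → Term (Fin n)) → (Fin l ⊎ Fin l) → Term (Fin n)
  eqIneqs F = [ F , (λ i → neg (F i)) ]

  boolIneqs : ∀ {n l} → (Fin l → Term (Fin n)) →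
              ((Fin l ⊎ Fin l) ⊎ ((Fin n ⊎ Fin n) ⊎ (Fin n ⊎ Fin n))) → Term (Fin n)
  boolIneqs F = [ eqIneqs F ,
                  [ [ boolAx , (λ i → neg (boolAx i)) ] ,
                    [ var , (λ i → con 1# ⊕ neg (var i)) ] ] ]

  BoolCPS : ∀ {b} (Neg : Carrier → Set b) {n l : ℕ} (F : Fin l → Term (Fin n))
            (p : Term (Fin n)) (s : ℕ) → Set (a ⊔ ℓ ⊔ b)
  BoolCPS Neg F p s = CPS Neg (boolIneqs F) p s

ℚ-ring : CommutativeRing Level.zero Level.zero
ℚ-ring = ℚP.+-*-commutativeRing

ℚ-Negative : ℚ.ℚ → Set
ℚ-Negative q = q ℚ.< ℚ.0ℚ

-- Each node t(x̄,ȳ) of the IPS circuit is simulated by four nodes of a conic circuit in x̄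
-- and the inequality variables which, once the inequalities are substituted, compute
-- base⁺, base⁻, shift⁺, shift⁻ with t(x̄,0̄) = base⁺ − base⁻ and
-- t(x̄,F̄) − t(x̄,0̄) = shift⁺ = −shift⁻. At a leaf this is arranged by hand: a constant is
-- a difference of non-negative constants, an axiom variable yᵢ gets shift± = ±fᵢ (the
-- inequalities fᵢ ≥ 0 and −fᵢ ≥ 0), and a variable x is either the axiom x ≥ 0
-- (boolean case) or ½(x+1)² − (½x² + ½) (over ℚ). Sums are simulated componentwise.
-- For a product, expanding t(x̄,0̄)·u(x̄,0̄) and t(x̄,F̄)·u(x̄,F̄) − t(x̄,0̄)·u(x̄,0̄) in these
-- terms and writing each −shift⁺ as shift⁻ gives the four new values as sums of products
-- of simulated nodes, so conicity is preserved. Each gate costs at most 24 nodes, and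
-- the shift⁺-node of the output computes p − C(x̄,0̄) = p.

module Submission where

open import Defs
open import Data.Nat using (ℕ; _≤_; _^_)
open import Data.Fin using (Fin)
open import Data.Product using (Σ; _×_)
open import Level using (Level)
open import Data.Rational using (ℚ)

open import Level using (_⊔_; lift)
open import Data.Nat using (suc; z≤n; s≤s)
import Data.Nat as Nat
open import Data.Nat.Properties
  using (+-monoˡ-≤; +-monoʳ-≤; *-monoʳ-≤; *-suc; ≤-trans; ≤-refl; m≤m+n; ^-monoˡ-≤; module ≤-Reasoning)
open import Data.Fin using (_≟_) renaming (zero to fzero; suc to fsuc)
open import Data.Sum using (_⊎_; inj₁; inj₂; [_,_])
open import Data.Product using (_,_; proj₁; proj₂; ∃₂)
open import Data.Empty using (⊥-elim)
open import Function using (_∘_)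
open import Relation.Nullary using (¬_; yes; no)
open import Relation.Binary.PropositionalEquality as ≡ using (_≡_; refl; cong; cong₂)
open import Relation.Binary.Structures using (IsTotalOrder)
open import Algebra.Bundles using (CommutativeRing)
import Algebra.Properties.CommutativeSemigroup as CommutativeSemigroupProperties
import Algebra.Solver.Ring.NaturalCoefficients.Default as NaturalSolver
import Relation.Binary.Reasoning.Setoid as SetoidReasoning
import Data.Rational as ℚ
import Data.Rational.Properties as ℚₚ

record Quad {q} (A : Set q) : Set q where
  constructor quad
  field base⁺ base⁻ shift⁺ shift⁻ : A
open Quad public

quad-cong : ∀ {q} {A : Set q} {a b c d a' b' c' d' : A} →
            a ≡ a' → b ≡ b' → c ≡ c' → d ≡ d' → quad a b c d ≡ quad a' b' c' d'
quad-cong refl refl refl refl = refl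

module _ {q r} {A : Set q} {B : Set r} where

  mapQ : (A → B) → Quad A → Quad B
  mapQ f (quad a b c d) = quad (f a) (f b) (f c) (f d)

  mapQ-cong : ∀ {f g : A → B} → (∀ x → f x ≡ g x) → ∀ u → mapQ f u ≡ mapQ g u
  mapQ-cong f≡g (quad a b c d) = quad-cong (f≡g a) (f≡g b) (f≡g c) (f≡g d)

  PointwiseQ : ∀ {p} → (A → B → Set p) → Quad A → Quad B → Set p
  PointwiseQ _∼_ (quad a b c d) (quad a' b' c' d') = a ∼ a' × b ∼ b' × c ∼ c' × d ∼ d'

AllQ : ∀ {q p} {A : Set q} → (A → Set p) → Quad A → Set p
AllQ P (quad a b c d) = P a × P b × P c × P d

allQ-map : ∀ {q r p s} {A : Set q} {B : Set r} {P : A → Set p} {Q : B → Set s} {f : A → B} →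
           (∀ {x} → P x → Q (f x)) → ∀ {u} → AllQ P u → AllQ Q (mapQ f u)
allQ-map pf (pa , pb , pc , pd) = pf pa , pf pb , pf pc , pf pd

module QuadArithmetic {q} {A : Set q} (_+_ _*_ : A → A → A) where

  _⊞_ : Quad A → Quad A → Quad A
  quad a⁺ a⁻ δa⁺ δa⁻ ⊞ quad b⁺ b⁻ δb⁺ δb⁻ =
    quad (a⁺ + b⁺) (a⁻ + b⁻) (δa⁺ + δb⁺) (δa⁻ + δb⁻)

  _⊠_ : Quad A → Quad A → Quad A
  quad a⁺ a⁻ δa⁺ δa⁻ ⊠ quad b⁺ b⁻ δb⁺ δb⁻ =
    quad ((a⁺ * b⁺) + (a⁻ * b⁻))
         ((a⁺ * b⁻) + (a⁻ * b⁺))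
         (((((a⁺ * δb⁺) + (a⁻ * δb⁻)) + (b⁺ * δa⁺)) + (b⁻ * δa⁻)) + (δa⁺ * δb⁺))
         (((((a⁺ * δb⁻) + (a⁻ * δb⁺)) + (b⁺ * δa⁻)) + (b⁻ * δa⁺)) + (δa⁻ * δb⁺))

  module _ {p} {P : A → Set p}
           (P-+ : ∀ {x y} → P x → P y → P (x + y))
           (P-* : ∀ {x y} → P x → P y → P (x * y)) where

    allQ-⊞ : ∀ {u v} → AllQ P u → AllQ P v → AllQ P (u ⊞ v)
    allQ-⊞ (a⁺ , a⁻ , δa⁺ , δa⁻) (b⁺ , b⁻ , δb⁺ , δb⁻) =
      P-+ a⁺ b⁺ , P-+ a⁻ b⁻ , P-+ δa⁺ δb⁺ , P-+ δa⁻ δb⁻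

    allQ-⊠ : ∀ {u v} → AllQ P u → AllQ P v → AllQ P (u ⊠ v)
    allQ-⊠ (a⁺ , a⁻ , δa⁺ , δa⁻) (b⁺ , b⁻ , δb⁺ , δb⁻) =
        P-+ (P-* a⁺ b⁺) (P-* a⁻ b⁻)
      , P-+ (P-* a⁺ b⁻) (P-* a⁻ b⁺)
      , P-+ (P-+ (P-+ (P-+ (P-* a⁺ δb⁺) (P-* a⁻ δb⁻)) (P-* b⁺ δa⁺)) (P-* b⁻ δa⁻)) (P-* δa⁺ δb⁺)
      , P-+ (P-+ (P-+ (P-+ (P-* a⁺ δb⁻) (P-* a⁻ δb⁺)) (P-* b⁺ δa⁻)) (P-* b⁻ δa⁺)) (P-* δa⁻ δb⁺)

module Representation {c ℓ} (R : CommutativeRing c ℓ) where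
  open CommutativeRing R renaming (refl to ≈-refl)
  open QuadArithmetic _+_ _*_
  open NaturalSolver commutativeSemiring using (solve; _:=_; _:+_; _:*_; con)
  open CommutativeSemigroupProperties +-commutativeSemigroup using (interchange)
  open SetoidReasoning setoid

  record Represents (u : Quad Carrier) (t₀ t₁ : Carrier) : Set ℓ where
    field
      base   : base⁺ u ≈ base⁻ u + t₀
      shift  : shift⁺ u + t₀ ≈ t₁
      cancel : shift⁻ u + shift⁺ u ≈ 0#
  open Represents public

  represents-base : ∀ {z⁺ z⁻ t} → z⁺ ≈ z⁻ + t → Represents (quad z⁺ z⁻ 0# 0#) t t
  represents-base z≈ = record
    { base = z≈ ; shift = +-identityˡ _ ; cancel = +-identityˡ 0# }

  represents-shift : ∀ {δ⁺ δ⁻ t} → δ⁺ ≈ t → δ⁻ + δ⁺ ≈ 0# → Represents (quad 0# 0# δ⁺ δ⁻) 0# t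
  represents-shift δ≈ δ-cancel = record
    { base = sym (+-identityˡ 0#) ; shift = trans (+-identityʳ _) δ≈ ; cancel = δ-cancel }

  represents-+ : ∀ {u v a₀ a₁ b₀ b₁} → Represents u a₀ a₁ → Represents v b₀ b₁ →
                 Represents (u ⊞ v) (a₀ + b₀) (a₁ + b₁)
  represents-+ {quad _ a⁻ _ _} {quad _ b⁻ _ _} {a₀} {_} {b₀} ra rb = record
    { base   = trans (+-cong (base ra) (base rb)) (interchange a⁻ a₀ b⁻ b₀)
    ; shift  = trans (interchange _ _ _ _) (+-cong (shift ra) (shift rb))
    ; cancel = trans (interchange _ _ _ _)
                 (trans (+-cong (cancel ra) (cancel rb)) (+-identityˡ 0#)) }

  represents-* : ∀ {u v a₀ a₁ b₀ b₁} → Represents u a₀ a₁ → Represents v b₀ b₁ →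
                 Represents (u ⊠ v) (a₀ * b₀) (a₁ * b₁)
  represents-* {quad a⁺ a⁻ δa⁺ δa⁻} {quad b⁺ b⁻ δb⁺ δb⁻} {a₀} {a₁} {b₀} {b₁} ra rb = record
    { base = begin
        a⁺ * b⁺ + a⁻ * b⁻                         ≈⟨ +-cong (*-cong (base ra) (base rb)) ≈-refl ⟩
        (a⁻ + a₀) * (b⁻ + b₀) + a⁻ * b⁻           ≈⟨ product-base a⁻ a₀ b⁻ b₀ ⟩
        ((a⁻ + a₀) * b⁻ + a⁻ * (b⁻ + b₀)) + a₀ * b₀
          ≈⟨ +-cong (+-cong (*-cong (sym (base ra)) ≈-refl) (*-cong ≈-refl (sym (base rb)))) ≈-refl ⟩
        (a⁺ * b⁻ + a⁻ * b⁺) + a₀ * b₀             ∎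
    ; shift = begin
        (a⁺ * δb⁺ + a⁻ * δb⁻ + b⁺ * δa⁺ + b⁻ * δa⁻ + δa⁺ * δb⁺) + a₀ * b₀
          ≈⟨ +-cong (+-cong (+-cong (+-cong (+-cong (*-cong (base ra) ≈-refl) ≈-refl)
                                           (*-cong (base rb) ≈-refl)) ≈-refl) ≈-refl) ≈-refl ⟩
        ((a⁻ + a₀) * δb⁺ + a⁻ * δb⁻ + (b⁻ + b₀) * δa⁺ + b⁻ * δa⁻ + δa⁺ * δb⁺) + a₀ * b₀
          ≈⟨ product-shift a⁻ a₀ b⁻ b₀ δa⁺ δa⁻ δb⁺ δb⁻ ⟩
        (a⁻ * (δb⁻ + δb⁺) + b⁻ * (δa⁻ + δa⁺)) + (δa⁺ + a₀) * (δb⁺ + b₀)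
          ≈⟨ +-cong (+-cong (*-cong ≈-refl (cancel rb)) (*-cong ≈-refl (cancel ra)))
                    (*-cong (shift ra) (shift rb)) ⟩
        (a⁻ * 0# + b⁻ * 0#) + a₁ * b₁             ≈⟨ +-cong (+-cong (zeroʳ a⁻) (zeroʳ b⁻)) ≈-refl ⟩
        (0# + 0#) + a₁ * b₁
          ≈⟨ trans (+-cong (+-identityˡ 0#) ≈-refl) (+-identityˡ _) ⟩
        a₁ * b₁                                   ∎
    ; cancel = begin
        (a⁺ * δb⁻ + a⁻ * δb⁺ + b⁺ * δa⁻ + b⁻ * δa⁺ + δa⁻ * δb⁺)
          + (a⁺ * δb⁺ + a⁻ * δb⁻ + b⁺ * δa⁺ + b⁻ * δa⁻ + δa⁺ * δb⁺)
          ≈⟨ product-cancel a⁺ a⁻ b⁺ b⁻ δa⁺ δa⁻ δb⁺ δb⁻ ⟩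
        ((a⁺ + a⁻) * (δb⁻ + δb⁺) + (b⁺ + b⁻) * (δa⁻ + δa⁺)) + (δa⁻ + δa⁺) * δb⁺
          ≈⟨ +-cong (+-cong (*-cong ≈-refl (cancel rb)) (*-cong ≈-refl (cancel ra)))
                    (*-cong (cancel ra) ≈-refl) ⟩
        ((a⁺ + a⁻) * 0# + (b⁺ + b⁻) * 0#) + 0# * δb⁺
          ≈⟨ +-cong (+-cong (zeroʳ _) (zeroʳ _)) (zeroˡ δb⁺) ⟩
        (0# + 0#) + 0#                            ≈⟨ trans (+-identityʳ _) (+-identityˡ 0#) ⟩
        0#                                        ∎ }
    where
    -- Semiring identities, stated with every term moved to the side where it is
    -- added, so that the natural-coefficient solver applies.
    product-base : ∀ a⁻ a₀ b⁻ b₀ →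
      (a⁻ + a₀) * (b⁻ + b₀) + a⁻ * b⁻ ≈ ((a⁻ + a₀) * b⁻ + a⁻ * (b⁻ + b₀)) + a₀ * b₀
    product-base = solve 4 (λ a⁻ a₀ b⁻ b₀ →
      (a⁻ :+ a₀) :* (b⁻ :+ b₀) :+ a⁻ :* b⁻ := ((a⁻ :+ a₀) :* b⁻ :+ a⁻ :* (b⁻ :+ b₀)) :+ a₀ :* b₀) ≈-refl

    product-shift : ∀ a⁻ a₀ b⁻ b₀ δa⁺ δa⁻ δb⁺ δb⁻ →
      ((a⁻ + a₀) * δb⁺ + a⁻ * δb⁻ + (b⁻ + b₀) * δa⁺ + b⁻ * δa⁻ + δa⁺ * δb⁺) + a₀ * b₀
      ≈ (a⁻ * (δb⁻ + δb⁺) + b⁻ * (δa⁻ + δa⁺)) + (δa⁺ + a₀) * (δb⁺ + b₀)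
    product-shift = solve 8 (λ a⁻ a₀ b⁻ b₀ δa⁺ δa⁻ δb⁺ δb⁻ →
      ((a⁻ :+ a₀) :* δb⁺ :+ a⁻ :* δb⁻ :+ (b⁻ :+ b₀) :* δa⁺ :+ b⁻ :* δa⁻ :+ δa⁺ :* δb⁺) :+ a₀ :* b₀
      := (a⁻ :* (δb⁻ :+ δb⁺) :+ b⁻ :* (δa⁻ :+ δa⁺)) :+ (δa⁺ :+ a₀) :* (δb⁺ :+ b₀)) ≈-refl

    product-cancel : ∀ a⁺ a⁻ b⁺ b⁻ δa⁺ δa⁻ δb⁺ δb⁻ →
      (a⁺ * δb⁻ + a⁻ * δb⁺ + b⁺ * δa⁻ + b⁻ * δa⁺ + δa⁻ * δb⁺)
        + (a⁺ * δb⁺ + a⁻ * δb⁻ + b⁺ * δa⁺ + b⁻ * δa⁻ + δa⁺ * δb⁺)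
      ≈ ((a⁺ + a⁻) * (δb⁻ + δb⁺) + (b⁺ + b⁻) * (δa⁻ + δa⁺)) + (δa⁻ + δa⁺) * δb⁺
    product-cancel = solve 8 (λ a⁺ a⁻ b⁺ b⁻ δa⁺ δa⁻ δb⁺ δb⁻ →
      (a⁺ :* δb⁻ :+ a⁻ :* δb⁺ :+ b⁺ :* δa⁻ :+ b⁻ :* δa⁺ :+ δa⁻ :* δb⁺)
        :+ (a⁺ :* δb⁺ :+ a⁻ :* δb⁻ :+ b⁺ :* δa⁺ :+ b⁻ :* δa⁻ :+ δa⁺ :* δb⁺)
      := ((a⁺ :+ a⁻) :* (δb⁻ :+ δb⁺) :+ (b⁺ :+ b⁻) :* (δa⁻ :+ δa⁺)) :+ (δa⁻ :+ δa⁺) :* δb⁺) ≈-refl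

  half-square-split : ∀ {h} → h + h ≈ 1# → ∀ x → h * ((x + 1#) * (x + 1#)) ≈ (h * (x * x) + h) + x
  half-square-split {h} h+h≈1 x = begin
    h * ((x + 1#) * (x + 1#))           ≈⟨ expand x h ⟩
    (h * (x * x) + h) + (h + h) * x     ≈⟨ +-cong ≈-refl (trans (*-cong h+h≈1 ≈-refl) (*-identityˡ x)) ⟩
    (h * (x * x) + h) + x               ∎
    where
    expand : ∀ x h → h * ((x + 1#) * (x + 1#)) ≈ (h * (x * x) + h) + (h + h) * x
    expand = solve 2 (λ x h →
      h :* ((x :+ con 1) :* (x :+ con 1)) := (h :* (x :* x) :+ h) :+ (h :+ h) :* x) ≈-refl

module _ {a ℓ} (R : CommutativeRing a ℓ) where
  open Poly R
  open CommutativeRing R using (0#; 1#)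

  termRing : Set → CommutativeRing a (a ⊔ ℓ)
  termRing V = record
    { Carrier = Term V
    ; _≈_ = _≃_
    ; _+_ = _⊕_
    ; _*_ = _⊗_
    ; -_ = neg
    ; 0# = con 0#
    ; 1# = con 1#
    ; isCommutativeRing = record
      { isRing = record
        { +-isAbelianGroup = record
          { isGroup = record
            { isMonoid = record
              { isSemigroup = record
                { isMagma = record
                  { isEquivalence = record { refl = ≃-refl ; sym = ≃-sym ; trans = ≃-trans }
                  ; ∙-cong = ⊕-cong }
                ; assoc = ⊕-assoc }
              ; identity = ⊕-idˡ , λ s → ≃-trans (⊕-comm s _) (⊕-idˡ s) }
            ; inverse = (λ s → ≃-trans (⊕-comm (neg s) s) (⊕-invʳ s)) , ⊕-invʳ
            ; ⁻¹-cong = ⊗-cong ≃-refl }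
          ; comm = ⊕-comm }
        ; *-cong = ⊗-cong
        ; *-assoc = ⊗-assoc
        ; *-identity = ⊗-idˡ , λ s → ≃-trans (⊗-comm s _) (⊗-idˡ s)
        ; distrib = distribˡ , λ s t u → ≃-trans (⊗-comm (t ⊕ u) s)
                      (≃-trans (distribˡ s t u) (⊕-cong (⊗-comm s t) (⊗-comm s u))) }
      ; *-comm = ⊗-comm } }

module Circuits {a ℓ b} (R : CommutativeRing a ℓ) {W : Set}
                (Bad : W → Set) (Neg : CommutativeRing.Carrier R → Set b) where
  open CommutativeRing R using (Carrier)
  open Poly R

  private variable
    k k' k₀ k₁ k₂ k₃ : ℕ

  infix 4 _≼_
  data _≼_ : SLP W k → SLP W k' → Set a where
    ≼-refl : {D : SLP W k} → D ≼ D
    ≼-step : {D : SLP W k} {D' : SLP W k'} {g : Gate W k'} → D ≼ D' → D ≼ D' ▷ g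

  ≼-trans : {D₁ : SLP W k₁} {D₂ : SLP W k₂} {D₃ : SLP W k₃} → D₁ ≼ D₂ → D₂ ≼ D₃ → D₁ ≼ D₃
  ≼-trans x ≼-refl     = x
  ≼-trans x (≼-step y) = ≼-step (≼-trans x y)

  weaken : {D : SLP W k} {D' : SLP W k'} → D ≼ D' → Fin k → Fin k'
  weaken ≼-refl     i = i
  weaken (≼-step x) i = fsuc (weaken x i)

  node-weaken : {D : SLP W k} {D' : SLP W k'} (x : D ≼ D') (i : Fin k) →
                node D' (weaken x i) ≡ node D i
  node-weaken ≼-refl     i = refl
  node-weaken (≼-step x) i = node-weaken x i

  Safe : SLP W k → Fin k → Set b
  Safe D i = ¬ UnsafeNode Bad Neg D i

  safe-weaken : {D : SLP W k} {D' : SLP W k'} (x : D ≼ D') {i : Fin k} →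
                Safe D i → Safe D' (weaken x i)
  safe-weaken ≼-refl     s = s
  safe-weaken (≼-step x) s = safe-weaken x s

  mul-unsafe⇒operand-unsafe : (D : SLP W k) (i j : Fin k) → UnsafeGate Bad Neg D (mul i j) →
                              UnsafeNode Bad Neg D i ⊎ UnsafeNode Bad Neg D j
  mul-unsafe⇒operand-unsafe D i j u with i ≟ j
  ... | yes _ = ⊥-elim (Level.lower u)
  ... | no  _ = u

  square-safe : (D : SLP W k) (i : Fin k) → ¬ UnsafeGate Bad Neg D (mul i i)
  square-safe D i u with i ≟ i
  ... | yes _   = Level.lower u
  ... | no  i≢i = i≢i refl

  infixl 6 _:+_
  infixl 7 _:*_
  data Expr (k : ℕ) : Set a where
    ref       : Fin k → Expr k
    cst       : Carrier → Expr k
    inp       : W → Expr k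
    _:+_ _:*_ : Expr k → Expr k → Expr k
    sq        : Expr k → Expr k

  eval : SLP W k → Expr k → Term W
  eval D (ref i)  = node D i
  eval D (cst c)  = con c
  eval D (inp w)  = var w
  eval D (e :+ f) = eval D e ⊕ eval D f
  eval D (e :* f) = eval D e ⊗ eval D f
  eval D (sq e)   = eval D e ⊗ eval D e

  data SafeExpr (D : SLP W k) : Expr k → Set (a ⊔ b) where
    ref  : ∀ {i} → Safe D i → SafeExpr D (ref i)
    cst  : ∀ {c} → ¬ Neg c → SafeExpr D (cst c)
    inp  : ∀ {w} → ¬ Bad w → SafeExpr D (inp w)
    _:+_ : ∀ {e f} → SafeExpr D e → SafeExpr D f → SafeExpr D (e :+ f)
    _:*_ : ∀ {e f} → SafeExpr D e → SafeExpr D f → SafeExpr D (e :* f)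
    sq   : ∀ {e} → SafeExpr D (sq e)

  nodesAfter : Expr k₀ → ℕ → ℕ
  nodesAfter (ref _)  k = k
  nodesAfter (cst _)  k = suc k
  nodesAfter (inp _)  k = suc k
  nodesAfter (e :+ f) k = suc (nodesAfter f (nodesAfter e k))
  nodesAfter (e :* f) k = suc (nodesAfter f (nodesAfter e k))
  nodesAfter (sq e)   k = suc (nodesAfter e k)

  Realizes : SLP W k₀ → Expr k₀ → SLP W k → Fin k → Set (a ⊔ b)
  Realizes D₀ e D i = node D i ≡ eval D₀ e × (SafeExpr D₀ e → Safe D i)

  realizes-weaken : {D₀ : SLP W k₀} {e : Expr k₀} {D : SLP W k} {D' : SLP W k'} {i : Fin k} →
                    (x : D ≼ D') → Realizes D₀ e D i → Realizes D₀ e D' (weaken x i)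
  realizes-weaken x (value , safe) = ≡.trans (node-weaken x _) value , safe-weaken x ∘ safe

  record Compiled (D : SLP W k) (D₀ : SLP W k₀) (e : Expr k₀) (k' : ℕ) : Set (a ⊔ b) where
    constructor compiled
    field
      circuit  : SLP W k'
      extends  : D ≼ circuit
      root     : Fin k'
      realizes : Realizes D₀ e circuit root

  compile : {D₀ : SLP W k₀} (D : SLP W k) → D₀ ≼ D → (e : Expr k₀) → Compiled D D₀ e (nodesAfter e k)
  compile D x (ref i) = compiled D ≼-refl (weaken x i) (node-weaken x i , λ { (ref s) → safe-weaken x s })
  compile D x (cst c) =
    compiled (D ▷ const c) (≼-step ≼-refl) fzero (refl , λ { (cst s) → s ∘ Level.lower })
  compile D x (inp w) =
    compiled (D ▷ input w) (≼-step ≼-refl) fzero (refl , λ { (inp s) → s ∘ Level.lower })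
  compile D x (e :+ f) =
    let compiled D₁ x₁ r₁ (v₁ , s₁) = compile D x e
        compiled D₂ x₂ r₂ (v₂ , s₂) = compile D₁ (≼-trans x x₁) f
    in compiled (D₂ ▷ add (weaken x₂ r₁) r₂) (≼-step (≼-trans x₁ x₂)) fzero
         ( cong₂ _⊕_ (≡.trans (node-weaken x₂ r₁) v₁) v₂
         , λ { (se :+ sf) → [ safe-weaken x₂ (s₁ se) , s₂ sf ] } )
  compile D x (e :* f) =
    let compiled D₁ x₁ r₁ (v₁ , s₁) = compile D x e
        compiled D₂ x₂ r₂ (v₂ , s₂) = compile D₁ (≼-trans x x₁) f
    in compiled (D₂ ▷ mul (weaken x₂ r₁) r₂) (≼-step (≼-trans x₁ x₂)) fzero
         ( cong₂ _⊗_ (≡.trans (node-weaken x₂ r₁) v₁) v₂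
         , λ { (se :* sf) → [ safe-weaken x₂ (s₁ se) , s₂ sf ] ∘ mul-unsafe⇒operand-unsafe D₂ _ _ } )
  compile D x (sq e) =
    let compiled D₁ x₁ r₁ (v₁ , _) = compile D x e
    in compiled (D₁ ▷ mul r₁ r₁) (≼-step x₁) fzero (cong₂ _⊗_ v₁ v₁ , λ _ → square-safe D₁ r₁)

  quadNodesAfter : Quad (Expr k₀) → ℕ → ℕ
  quadNodesAfter (quad e₁ e₂ e₃ e₄) k = nodesAfter e₄ (nodesAfter e₃ (nodesAfter e₂ (nodesAfter e₁ k)))

  record CompiledQuad (D₀ : SLP W k₀) (u : Quad (Expr k₀)) (k : ℕ) : Set (a ⊔ b) where
    field
      circuit  : SLP W k
      extends  : D₀ ≼ circuit
      roots    : Quad (Fin k)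
      realizes : PointwiseQ (λ e i → Realizes D₀ e circuit i) u roots

  compileQuad : (D₀ : SLP W k₀) (u : Quad (Expr k₀)) → CompiledQuad D₀ u (quadNodesAfter u k₀)
  compileQuad D₀ (quad e₁ e₂ e₃ e₄) =
    let compiled D₁ x₁ r₁ ρ₁ = compile D₀ ≼-refl e₁
        compiled D₂ x₂ r₂ ρ₂ = compile D₁ x₁ e₂
        compiled D₃ x₃ r₃ ρ₃ = compile D₂ (≼-trans x₁ x₂) e₃
        compiled D₄ x₄ r₄ ρ₄ = compile D₃ (≼-trans (≼-trans x₁ x₂) x₃) e₄
        x₂₃₄ = ≼-trans (≼-trans x₂ x₃) x₄
        x₃₄  = ≼-trans x₃ x₄
    in record
      { circuit  = D₄
      ; extends  = ≼-trans x₁ x₂₃₄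
      ; roots    = quad (weaken x₂₃₄ r₁) (weaken x₃₄ r₂) (weaken x₄ r₃) r₄
      ; realizes = realizes-weaken x₂₃₄ ρ₁ , realizes-weaken x₃₄ ρ₂ , realizes-weaken x₄ ρ₃ , ρ₄ }

linear≤sixth-power : ∀ s {k} → 2 ≤ s → k ≤ s Nat.* 24 → 2 Nat.+ k ≤ s ^ 6
linear≤sixth-power s {k} 2≤s k≤24s = begin
  2 Nat.+ k              ≤⟨ +-monoʳ-≤ 2 k≤24s ⟩
  2 Nat.+ s Nat.* 24     ≤⟨ +-monoˡ-≤ (s Nat.* 24) 2≤s ⟩
  s Nat.+ s Nat.* 24     ≡⟨ *-suc s 24 ⟨
  s Nat.* 25             ≤⟨ *-monoʳ-≤ s (≤-trans (m≤m+n 25 7) (^-monoˡ-≤ 5 2≤s)) ⟩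
  s Nat.* s ^ 5          ∎
  where open ≤-Reasoning

module IPS⇒CPS {a ℓ b} (R : CommutativeRing a ℓ) (Neg : CommutativeRing.Carrier R → Set b) where
  open CommutativeRing R using (Carrier; 0#; 1#) renaming (_≈_ to _≈R_; _+_ to _+R_)
  open Poly R

  -- How an x-leaf is written as a difference of conic terms: either x ≥ 0 is one
  -- of the given inequalities, or 2 has a non-negative inverse h and
  -- x = h (x + 1)² − (h x² + h).
  data XDecomposition {n} {J : Set} (H : J → Term (Fin n)) : Set (a ⊔ ℓ ⊔ b) where
    x≥0-axioms : (x≥0 : Fin n → J) → (∀ i → H (x≥0 i) ≃ var i) → XDecomposition H
    half       : (h : Carrier) → ¬ Neg h → h +R h ≈R 1# → XDecomposition H

  module Simulation
    (0≮0   : ¬ Neg 0#)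
    (split : ∀ c → ∃₂ λ c⁺ c⁻ → ¬ Neg c⁺ × ¬ Neg c⁻ × c⁺ ≈R c⁻ +R c)
    {n : ℕ} {I J : Set} (G : I → Term (Fin n)) (H : J → Term (Fin n))
    (y≥0 y≤0 : I → J) (H-y≥0 : ∀ i → H (y≥0 i) ≃ G i) (H-y≤0 : ∀ i → H (y≤0 i) ≃ neg (G i))
    (xdec : XDecomposition H)
    where

    V W : Set
    V = Fin n ⊎ I
    W = Fin n ⊎ J

    open Circuits R {W} IsX Neg
    open module ExprQuad {k} = QuadArithmetic {A = Expr k} _:+_ _:*_
    open Representation (termRing R (Fin n))
      using (Represents; shift; represents-base; represents-shift; represents-+; represents-*;
             half-square-split)
    open CommutativeRing (termRing R (Fin n)) using (-‿inverseˡ)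

    private variable
      k k' k₀ m : ℕ

    atZero atF : Term V → Term (Fin n)
    atZero = subst zeroes
    atF    = subst [ var , G ]

    atH : Term W → Term (Fin n)
    atH = subst [ var , H ]

    record Simulates (D : SLP W k) (ix : Quad (Fin k)) (t : Term V) : Set (a ⊔ ℓ ⊔ b) where
      field
        represents : Represents (mapQ (atH ∘ node D) ix) (atZero t) (atF t)
        safe       : AllQ (Safe D) ix
    open Simulates

    simulates-weaken : ∀ {D : SLP W k} {D' : SLP W k'} {ix t} (x : D ≼ D') →
                       Simulates D ix t → Simulates D' (mapQ (weaken x) ix) t
    simulates-weaken {D = D} {D'} {ix} x g = record
      { represents = ≡.subst (λ u → Represents u _ _)
                       (≡.sym (mapQ-cong (cong atH ∘ node-weaken x) ix)) (represents g)
      ; safe       = allQ-map {P = Safe D} {Q = Safe D'} (safe-weaken x) (safe g) }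

    realizes⇒simulates : ∀ {D₀ : SLP W k₀} {D : SLP W k} {u ix t} →
                    PointwiseQ (λ e i → Realizes D₀ e D i) u ix →
                    Represents (mapQ (atH ∘ eval D₀) u) (atZero t) (atF t) → AllQ (SafeExpr D₀) u →
                    Simulates D ix t
    realizes⇒simulates {u = quad _ _ _ _} {ix = quad _ _ _ _}
                  ((v₁ , s₁) , (v₂ , s₂) , (v₃ , s₃) , (v₄ , s₄)) rep (e₁ , e₂ , e₃ , e₄)
      = record
      { represents = ≡.subst (λ u → Represents u _ _) (≡.sym (cong (mapQ atH) (quad-cong v₁ v₂ v₃ v₄))) rep
      ; safe       = s₁ e₁ , s₂ e₂ , s₃ e₃ , s₄ e₄ }

    xGadget : XDecomposition H → Fin n → Quad (Expr k)
    xGadget (x≥0-axioms x≥0 _) i = quad (inp (inj₂ (x≥0 i))) (cst 0#) (cst 0#) (cst 0#)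
    xGadget (half h _ _)        i =
      quad (cst h :* sq (inp (inj₁ i) :+ cst 1#)) (cst h :* sq (inp (inj₁ i)) :+ cst h) (cst 0#) (cst 0#)

    gadget : (Fin m → Quad (Fin k)) → Gate V m → Quad (Expr k)
    gadget ρ (input (inj₁ i)) = xGadget xdec i
    gadget ρ (input (inj₂ i)) = quad (cst 0#) (cst 0#) (inp (inj₂ (y≥0 i))) (inp (inj₂ (y≤0 i)))
    gadget ρ (const c)        = let (c⁺ , c⁻ , _) = split c in quad (cst c⁺) (cst c⁻) (cst 0#) (cst 0#)
    gadget ρ (add i j)        = mapQ ref (ρ i) ⊞ mapQ ref (ρ j)
    gadget ρ (mul i j)        = mapQ ref (ρ i) ⊠ mapQ ref (ρ j)

    xGadget-size : (d : XDecomposition H) (i : Fin n) → quadNodesAfter (xGadget {k = k} d i) k ≤ 24 Nat.+ k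
    xGadget-size {k = k} (x≥0-axioms _ _) i = +-monoˡ-≤ k (m≤m+n 4 20)
    xGadget-size {k = k} (half _ _ _)     i = +-monoˡ-≤ k (m≤m+n 14 10)

    xGadget-represents : {D₀ : SLP W k} (d : XDecomposition H) (i : Fin n) →
                         Represents (mapQ (atH ∘ eval D₀) (xGadget d i)) (var i) (var i)
    xGadget-represents (x≥0-axioms _ H≃x) i = represents-base (≃-trans (H≃x i) (≃-sym (⊕-idˡ _)))
    xGadget-represents (half h _ h+h≈1)   i =
      represents-base (half-square-split (≃-trans (con-+ h h) (con-cong h+h≈1)) (var i))

    xGadget-safe : {D₀ : SLP W k} (d : XDecomposition H) (i : Fin n) → AllQ (SafeExpr D₀) (xGadget d i)
    xGadget-safe (x≥0-axioms _ _) i = inp (λ ()) , cst 0≮0 , cst 0≮0 , cst 0≮0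
    xGadget-safe (half _ h≮0 _)   i = cst h≮0 :* sq , cst h≮0 :* sq :+ cst h≮0 , cst 0≮0 , cst 0≮0

    gadget-size : (ρ : Fin m → Quad (Fin k)) (g : Gate V m) → quadNodesAfter (gadget ρ g) k ≤ 24 Nat.+ k
    gadget-size         ρ (input (inj₁ i)) = xGadget-size xdec i
    gadget-size {k = k} ρ (input (inj₂ i)) = +-monoˡ-≤ k (m≤m+n 4 20)
    gadget-size {k = k} ρ (const c)        = +-monoˡ-≤ k (m≤m+n 4 20)
    gadget-size {k = k} ρ (add i j)        = +-monoˡ-≤ k (m≤m+n 4 20)
    gadget-size         ρ (mul i j)        = ≤-refl

    module _ {C : SLP V m} {D₀ : SLP W k} {ρ : Fin m → Quad (Fin k)}
             (sim : ∀ i → Simulates D₀ (ρ i) (node C i)) where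

      gadget-represents : ∀ g →
        Represents (mapQ (atH ∘ eval D₀) (gadget ρ g)) (atZero (gate C g)) (atF (gate C g))
      gadget-represents (input (inj₁ i)) = xGadget-represents xdec i
      gadget-represents (input (inj₂ i)) =
        represents-shift (H-y≥0 i) (≃-trans (⊕-cong (H-y≤0 i) (H-y≥0 i)) (-‿inverseˡ (G i)))
      gadget-represents (const c) =
        represents-base (≃-trans (con-cong (proj₂ (proj₂ (proj₂ (proj₂ (split c)))))) (≃-sym (con-+ _ c)))
      gadget-represents (add i j) = represents-+ (represents (sim i)) (represents (sim j))
      gadget-represents (mul i j) = represents-* (represents (sim i)) (represents (sim j))

      refs-safe : ∀ i → AllQ (SafeExpr D₀) (mapQ ref (ρ i))
      refs-safe i = allQ-map {P = Safe D₀} {Q = SafeExpr D₀} ref (safe (sim i))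

      gadget-safe : ∀ g → AllQ (SafeExpr D₀) (gadget ρ g)
      gadget-safe (input (inj₁ i)) = xGadget-safe xdec i
      gadget-safe (input (inj₂ i)) = cst 0≮0 , cst 0≮0 , inp (λ ()) , inp (λ ())
      gadget-safe (const c) =
        let (_ , _ , c⁺≮0 , c⁻≮0 , _) = split c in cst c⁺≮0 , cst c⁻≮0 , cst 0≮0 , cst 0≮0
      gadget-safe (add i j) = allQ-⊞ {P = SafeExpr D₀} _:+_ _:*_ (refs-safe i) (refs-safe j)
      gadget-safe (mul i j) = allQ-⊠ {P = SafeExpr D₀} _:+_ _:*_ (refs-safe i) (refs-safe j)

    record Translation (C : SLP V m) : Set (a ⊔ ℓ ⊔ b) where
      field
        {size}     : ℕ
        circuit    : SLP W size
        size-bound : size ≤ m Nat.* 24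
        nodes      : Fin m → Quad (Fin size)
        simulates  : ∀ i → Simulates circuit (nodes i) (node C i)

    translate : (C : SLP V m) → Translation C
    translate [] = record { circuit = [] ; size-bound = z≤n ; nodes = λ () ; simulates = λ () }
    translate {suc m} (C ▷ g) = record
      { circuit    = CompiledQuad.circuit Q
      ; size-bound = ≤-trans (gadget-size (nodes T) g) (+-monoʳ-≤ 24 (size-bound T))
      ; nodes      = nodes′
      ; simulates  = simulates′ }
      where
      open Translation
      T : Translation C
      T = translate C

      Q : CompiledQuad (circuit T) (gadget (nodes T) g) (quadNodesAfter (gadget (nodes T) g) (size T))
      Q = compileQuad (circuit T) (gadget (nodes T) g)

      nodes′ : Fin (suc m) → Quad (Fin (quadNodesAfter (gadget (nodes T) g) (size T)))
      nodes′ fzero    = CompiledQuad.roots Q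
      nodes′ (fsuc i) = mapQ (weaken (CompiledQuad.extends Q)) (nodes T i)

      simulates′ : ∀ i → Simulates (CompiledQuad.circuit Q) (nodes′ i) (node (C ▷ g) i)
      simulates′ fzero    = realizes⇒simulates (CompiledQuad.realizes Q)
                              (gadget-represents {C = C} (simulates T) g) (gadget-safe {C = C} (simulates T) g)
      simulates′ (fsuc i) = simulates-weaken (CompiledQuad.extends Q) (simulates T i)

    cps-of-zero : ∀ {p} → con 0# ≃ p → CPS Neg H p 1
    cps-of-zero 0≃p = record
      { circuit = [] ▷ const 0# ; nonempty = s≤s z≤n ; conic = 0≮0 ∘ Level.lower ; at-H = 0≃p }

    leaf-proof : (g : Gate V 0) → atZero (gate [] g) ≃ con 0# → ∀ {p} → atF (gate [] g) ≃ p → CPS Neg H p 1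
    leaf-proof (input (inj₁ i)) x≃0 x≃p = cps-of-zero (≃-trans (≃-sym x≃0) x≃p)
    leaf-proof (const c)        c≃0 c≃p = cps-of-zero (≃-trans (≃-sym c≃0) c≃p)
    leaf-proof (input (inj₂ i)) _   G≃p = record
      { circuit = [] ▷ input (inj₂ (y≥0 i)) ; nonempty = s≤s z≤n ; conic = λ { (lift ()) }
      ; at-H = ≃-trans (H-y≥0 i) G≃p }

    -- Adding a zero constant makes the shift⁺-node of the IPS output, which computes
    -- C(x̄,F̄) − C(x̄,0̄) = p, the last node.
    ips⇒cps : ∀ {s p} (C : SLP V s) → 1 ≤ s → atZero (out C) ≃ con 0# → atF (out C) ≃ p →
              Σ ℕ λ s' → s' ≤ s ^ 6 × CPS Neg H p s'
    ips⇒cps [] ()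
    ips⇒cps ([] ▷ g) _ C₀≃0 Cᶠ≃p = 1 , ≤-refl , leaf-proof g C₀≃0 Cᶠ≃p
    ips⇒cps {s@(suc (suc _))} (C ▷ g) _ C₀≃0 Cᶠ≃p =
      2 Nat.+ size , linear≤sixth-power s (s≤s (s≤s z≤n)) size-bound , record
        { circuit  = circuit ▷ const 0# ▷ add (fsuc δ) fzero
        ; nonempty = s≤s z≤n
        ; conic    = [ δ-safe , 0≮0 ∘ Level.lower ]
        ; at-H     = ≃-trans (⊕-cong ≃-refl (≃-sym C₀≃0))
                       (≃-trans (shift (represents (simulates fzero))) Cᶠ≃p) }
      where
      open Translation (translate (C ▷ g))

      δ : Fin size
      δ = shift⁺ (nodes fzero)

      δ-safe : Safe circuit δ
      δ-safe = proj₁ (proj₂ (proj₂ (safe (simulates fzero))))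

¬ℚ-Negative-0 : ¬ ℚ-Negative ℚ.0ℚ
¬ℚ-Negative-0 = ℚₚ.<-irrefl refl

0≤⇒¬ℚ-Negative : ∀ {x} → ℚ.0ℚ ℚ.≤ x → ¬ ℚ-Negative x
0≤⇒¬ℚ-Negative 0≤x x<0 = ℚₚ.<-irrefl refl (ℚₚ.≤-<-trans 0≤x x<0)

ℚ-difference-of-nonNegatives : ∀ c → ∃₂ λ c⁺ c⁻ → ¬ ℚ-Negative c⁺ × ¬ ℚ-Negative c⁻ × c⁺ ≡ c⁻ ℚ.+ c
ℚ-difference-of-nonNegatives c with ℚₚ.≤-total ℚ.0ℚ c
... | inj₁ 0≤c = c , ℚ.0ℚ , 0≤⇒¬ℚ-Negative 0≤c , ¬ℚ-Negative-0 , ≡.sym (ℚₚ.+-identityˡ c)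
... | inj₂ c≤0 =
  ℚ.0ℚ , ℚ.- c , ¬ℚ-Negative-0 , 0≤⇒¬ℚ-Negative (ℚₚ.neg-antimono-≤ c≤0) , ≡.sym (ℚₚ.+-inverseˡ c)

module OrderedCommRingProperties {a ℓ₁ ℓ₂} (R : OrderedCommRing a ℓ₁ ℓ₂) where
  open OrderedCommRing R renaming (_≤_ to _≤R_; refl to ≈-refl)
  open IsTotalOrder isTotalOrder using (antisym; total; ≤-respˡ-≈; ≤-respʳ-≈)

  ¬Negative-0 : ¬ Negative 0#
  ¬Negative-0 (_ , 0≉0) = 0≉0 ≈-refl

  0≤⇒¬Negative : ∀ {x} → 0# ≤R x → ¬ Negative x
  0≤⇒¬Negative 0≤x (x≤0 , x≉0) = x≉0 (antisym x≤0 0≤x)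

  ≤0⇒0≤- : ∀ {x} → x ≤R 0# → 0# ≤R (- x)
  ≤0⇒0≤- {x} x≤0 = ≤-respʳ-≈ (+-identityˡ (- x)) (≤-respˡ-≈ (-‿inverseʳ x) (+-mono-≤ (- x) x≤0))

  difference-of-nonNegatives : ∀ c → ∃₂ λ c⁺ c⁻ → ¬ Negative c⁺ × ¬ Negative c⁻ × c⁺ ≈ c⁻ + c
  difference-of-nonNegatives c with total 0# c
  ... | inj₁ 0≤c = c , 0# , 0≤⇒¬Negative 0≤c , ¬Negative-0 , sym (+-identityˡ c)
  ... | inj₂ c≤0 = 0# , - c , ¬Negative-0 , 0≤⇒¬Negative (≤0⇒0≤- c≤0) , sym (-‿inverseˡ c)

algebraicIPS⇒CPS : ∀ (n l : ℕ) (F : Fin l → Poly.Term ℚ-ring (Fin n)) (p : Poly.Term ℚ-ring (Fin n))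
                   (s : ℕ) →
                   Poly.AlgIPS ℚ-ring F p s →
                   Σ ℕ λ s' → (s' ≤ s ^ 6) × Poly.CPS ℚ-ring ℚ-Negative (Poly.eqIneqs ℚ-ring F) p s'
algebraicIPS⇒CPS n l F p s π = ips⇒cps circuit nonempty at-zero at-F
  where
  open Poly ℚ-ring
  open AlgIPS π
  open IPS⇒CPS ℚ-ring ℚ-Negative
  open Simulation ¬ℚ-Negative-0 ℚ-difference-of-nonNegatives F (eqIneqs F) inj₁ inj₂
                   (λ _ → ≃-refl) (λ _ → ≃-refl) (half ℚ.½ (0≤⇒¬ℚ-Negative (ℚₚ.nonNegative⁻¹ ℚ.½)) refl)

booleanIPS⇒CPS : ∀ {a ℓ₁ ℓ₂ : Level} (R : OrderedCommRing a ℓ₁ ℓ₂) (n l : ℕ)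
                 (F : Fin l → Poly.Term (OrderedCommRing.commutativeRing R) (Fin n))
                 (p : Poly.Term (OrderedCommRing.commutativeRing R) (Fin n)) (s : ℕ) →
                 Poly.BoolIPS (OrderedCommRing.commutativeRing R) F p s →
                 Σ ℕ λ s' → (s' ≤ s ^ 6) ×
                   Poly.BoolCPS (OrderedCommRing.commutativeRing R) (OrderedCommRing.Negative R) F p s'
booleanIPS⇒CPS R n l F p s π = ips⇒cps circuit nonempty at-zero at-F
  where
  open OrderedCommRing R using (commutativeRing; Negative)
  open OrderedCommRingProperties R
  open Poly commutativeRing
  open BoolIPS π
  open IPS⇒CPS commutativeRing Negative

  y≥0 y≤0 : Fin l ⊎ Fin n → (Fin l ⊎ Fin l) ⊎ ((Fin n ⊎ Fin n) ⊎ (Fin n ⊎ Fin n))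
  y≥0 (inj₁ i) = inj₁ (inj₁ i)
  y≥0 (inj₂ i) = inj₂ (inj₁ (inj₁ i))
  y≤0 (inj₁ i) = inj₁ (inj₂ i)
  y≤0 (inj₂ i) = inj₂ (inj₁ (inj₂ i))

  H-y≥0 : ∀ i → boolIneqs F (y≥0 i) ≃ [ F , boolAx ] i
  H-y≥0 (inj₁ _) = ≃-refl
  H-y≥0 (inj₂ _) = ≃-refl

  H-y≤0 : ∀ i → boolIneqs F (y≤0 i) ≃ neg ([ F , boolAx ] i)
  H-y≤0 (inj₁ _) = ≃-refl
  H-y≤0 (inj₂ _) = ≃-refl

  open Simulation ¬Negative-0 difference-of-nonNegatives [ F , boolAx ] (boolIneqs F) y≥0 y≤0 H-y≥0 H-y≤0
                   (x≥0-axioms (inj₂ ∘ inj₂ ∘ inj₁) (λ _ → ≃-refl))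

theorem4p9 :
    Σω ℕ λ c →
      (∀ (n l : ℕ) (F : Fin l → Poly.Term ℚ-ring (Fin n)) (p : Poly.Term ℚ-ring (Fin n)) (s : ℕ) →
         Poly.AlgIPS ℚ-ring F p s →
         Σ ℕ λ s' → (s' ≤ s ^ c) × Poly.CPS ℚ-ring ℚ-Negative (Poly.eqIneqs ℚ-ring F) p s')
      ×ω
      (∀ {a ℓ₁ ℓ₂ : Level} (R : OrderedCommRing a ℓ₁ ℓ₂) (n l : ℕ)
         (F : Fin l → Poly.Term (OrderedCommRing.commutativeRing R) (Fin n))
         (p : Poly.Term (OrderedCommRing.commutativeRing R) (Fin n)) (s : ℕ) →
         Poly.BoolIPS (OrderedCommRing.commutativeRing R) F p s →
         Σ ℕ λ s' → (s' ≤ s ^ c) ×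
           Poly.BoolCPS (OrderedCommRing.commutativeRing R) (OrderedCommRing.Negative R) F p s')
theorem4p9 = 6 ,ω (algebraicIPS⇒CPS , booleanIPS⇒CPS)
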